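{- For every natural number $d\ge 2$ and every natural number $n$, there exist $n$ points $P_1,\dots,P_n$ in $\mathbb{R}^d$ such that for every $1\le i<j\le d$, the projections of these points onto the $(i,j)$-plane are in convex position, and they appear in the same (cyclic) order on the convex hull for every choice of $i<j$.
   Context: The $(i,j)$-plane projection of $q\in\mathbb{R}^d$ is $(q_i,q_j)$, i.e. the projection onto the plane spanned by the $i$-th and $j$-th coordinate axes. -}

module Defs where

open import Data.Nat using (ℕ)
open import Data.Fin using (Fin) renaming (_<_ to _<ᶠ_)
open import Data.Rational using (ℚ; 0ℚ; _-_; _*_; _<_)
open import Data.Product using (_×_; _,_; proj₁; proj₂)
open import Data.Sum using (_⊎_)
open import Relation.Binary.PropositionalEquality using (_≡_)
open import Relation.Nullary using (¬_)

-- Points of ℚ^d (rational stand-in for ℝ^d) and of the plane.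
Point : ℕ → Set
Point d = Fin d → ℚ

Point2 : Set
Point2 = ℚ × ℚ

proj : ∀ {d} → Fin d → Fin d → Point d → Point2
proj i j q = (q i , q j)

-- Orientation determinant of the triple (a, b, c):
-- (b - a) × (c - a); positive = counterclockwise, negative = clockwise, 0 = collinear.
orient : Point2 → Point2 → Point2 → ℚ
orient (ax , ay) (bx , by) (cx , cy) =
  ((bx - ax) * (cy - ay)) - ((by - ay) * (cx - ax))

Distinct : ∀ {n} → (Fin n → Point2) → Set
Distinct {n} q = (a b : Fin n) → ¬ (a ≡ b) → ¬ (q a ≡ q b)

-- The points q 0, …, q (n-1) are in (strictly) convex position and appear
-- in this cyclic order along the boundary of their convex hull
-- (either counterclockwise or clockwise): every ordered triple a < b < c
-- has the same nonzero orientation.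
ConvexInOrder : ∀ {n} → (Fin n → Point2) → Set
ConvexInOrder {n} q =
  Distinct q ×
  ( ((a b c : Fin n) → a <ᶠ b → b <ᶠ c → 0ℚ < orient (q a) (q b) (q c))
  ⊎ ((a b c : Fin n) → a <ᶠ b → b <ᶠ c → orient (q a) (q b) (q c) < 0ℚ) )

{-# OPTIONS --safe #-}
-- Take the point P k whose i-th coordinate is k + i·k². Its (i,j)-projection lies on the
-- curve x ↦ (x + i x², x + j x²), an affine image of the parabola (x, x²) when i ≠ j, and
-- three of its points x < y < z have orientation (j − i)(y − x)(z − x)(z − y) > 0. So every
-- such projection is in convex position, traversed counterclockwise in the order of k.
module Submission where

open import Defs
open import Data.Nat as ℕ using (ℕ; zero; suc; _≥_)
open import Data.Nat.Properties using (m<1+n⇒m<n∨m≡n)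
open import Data.Fin using (Fin; toℕ) renaming (_<_ to _<ᶠ_)
open import Data.Fin.Properties using (<-cmp)
open import Data.Product using (Σ; _,_; proj₁)
open import Data.Sum using (inj₁; inj₂)
open import Data.Rational using (ℚ; 0ℚ; 1ℚ; _+_; _-_; _*_; -_; _<_; Positive; NonNegative; positive)
open import Data.Rational.Properties
  using ( _≟_; +-*-commutativeRing; +-identityʳ; +-inverseʳ; +-monoˡ-<; +-monoʳ-<
        ; <-irrefl; <-trans; positive⁻¹; pos⇒nonNeg
        ; pos*pos⇒pos; pos+nonNeg⇒pos; nonNeg+pos⇒pos; nonNeg+nonNeg⇒nonNeg; nonNeg*nonNeg⇒nonNeg )
open import Level using (0ℓ)
open import Relation.Binary.Definitions using (tri<; tri≈; tri>)
open import Relation.Binary.PropositionalEquality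
  using (_≡_; _≢_; refl; sym; cong; subst; module ≡-Reasoning)
open import Relation.Nullary using (contradiction)
open import Relation.Nullary.Decidable using (dec⇒maybe)
open import Tactic.RingSolver using (solve-∀)
open import Tactic.RingSolver.Core.AlmostCommutativeRing
  using (AlmostCommutativeRing; fromCommutativeRing)

ℚ-ring : AlmostCommutativeRing 0ℓ 0ℓ
ℚ-ring = fromCommutativeRing +-*-commutativeRing λ x → dec⇒maybe (0ℚ ≟ x)

<⇒positive-diff : ∀ {p q} → p < q → Positive (q - p)
<⇒positive-diff {p} {q} p<q =
  positive (subst (_< q - p) (+-inverseʳ p) (+-monoˡ-< (- p) p<q))

p<p+1 : ∀ p → p < p + 1ℚ
p<p+1 p = subst (_< p + 1ℚ) (+-identityʳ p) (+-monoʳ-< p (positive⁻¹ 1ℚ))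

toℚ : ℕ → ℚ
toℚ zero    = 0ℚ
toℚ (suc n) = toℚ n + 1ℚ

toℚ-nonNeg : ∀ n → NonNegative (toℚ n)
toℚ-nonNeg zero    = _
toℚ-nonNeg (suc n) = pos⇒nonNeg (toℚ n + 1ℚ) {{nonNeg+pos⇒pos (toℚ n) {{toℚ-nonNeg n}} 1ℚ}}

toℚ-mono-< : ∀ {m n} → m ℕ.< n → toℚ m < toℚ n
toℚ-mono-< {n = suc n} m<1+n with m<1+n⇒m<n∨m≡n m<1+n
... | inj₁ m<n  = <-trans (toℚ-mono-< m<n) (p<p+1 (toℚ n))
... | inj₂ refl = p<p+1 (toℚ n)

parabola : ℚ → ℚ → ℚ
parabola t x = x + t * (x * x)

parabolas : ℚ → ℚ → ℚ → Point2
parabolas s t x = (parabola s x , parabola t x)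

-- The ring solver does not unfold definitions, so each identity is first stated expanded.
parabola-sub : ∀ t x y → parabola t y - parabola t x ≡ (y - x) * (1ℚ + t * (x + y))
parabola-sub = expanded
  where
  expanded : ∀ t x y →
    (y + t * (y * y)) - (x + t * (x * x)) ≡ (y - x) * (1ℚ + t * (x + y))
  expanded = solve-∀ ℚ-ring

orient-parabolas : ∀ s t x y z →
  orient (parabolas s t x) (parabolas s t y) (parabolas s t z)
    ≡ (t - s) * ((y - x) * ((z - x) * (z - y)))
orient-parabolas = expanded
  where
  expanded : ∀ s t x y z →
    let X u = u + s * (u * u); Y u = u + t * (u * u) in
    (X y - X x) * (Y z - Y x) - (Y y - Y x) * (X z - X x)
      ≡ (t - s) * ((y - x) * ((z - x) * (z - y)))
  expanded = solve-∀ ℚ-ring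

parabola-injective : ∀ {t x y} .{{_ : NonNegative t}} .{{_ : NonNegative x}}
                     .{{_ : NonNegative y}} → x < y → parabola t x ≢ parabola t y
parabola-injective {t} {x} {y} x<y eq = <-irrefl (sym sub≡0) 0<sub
  where
  open ≡-Reasoning
  sub≡0 : (y - x) * (1ℚ + t * (x + y)) ≡ 0ℚ
  sub≡0 = begin
    (y - x) * (1ℚ + t * (x + y)) ≡⟨ parabola-sub t x y ⟨
    parabola t y - parabola t x  ≡⟨ cong (_- parabola t x) eq ⟨
    parabola t x - parabola t x  ≡⟨ +-inverseʳ (parabola t x) ⟩
    0ℚ                           ∎
  instance
    _ = <⇒positive-diff x<y
    _ = nonNeg+nonNeg⇒nonNeg x y
    _ = nonNeg*nonNeg⇒nonNeg t (x + y)
    _ = pos+nonNeg⇒pos 1ℚ (t * (x + y))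
  0<sub : 0ℚ < (y - x) * (1ℚ + t * (x + y))
  0<sub = positive⁻¹ _ {{pos*pos⇒pos (y - x) (1ℚ + t * (x + y))}}

orient-parabolas-pos : ∀ {s t x y z} → s < t → x < y → y < z →
  0ℚ < orient (parabolas s t x) (parabolas s t y) (parabolas s t z)
orient-parabolas-pos {s} {t} {x} {y} {z} s<t x<y y<z =
  subst (0ℚ <_) (sym (orient-parabolas s t x y z)) (positive⁻¹ _)
  where
  instance
    _ = <⇒positive-diff s<t
    _ = <⇒positive-diff x<y
    _ = <⇒positive-diff y<z
    _ = <⇒positive-diff (<-trans x<y y<z)
    _ = pos*pos⇒pos (z - x) (z - y)
    _ = pos*pos⇒pos (y - x) ((z - x) * (z - y))
    _ = pos*pos⇒pos (t - s) ((y - x) * ((z - x) * (z - y)))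

Distinct-from-< : ∀ {n} {q : Fin n → Point2} →
                  (∀ {a b} → a <ᶠ b → q a ≢ q b) → Distinct q
Distinct-from-< q≢ a b a≢b with <-cmp a b
... | tri< a<b _   _   = q≢ a<b
... | tri≈ _   a≡b _   = contradiction a≡b a≢b
... | tri> _   _   b<a = λ qa≡qb → q≢ b<a (sym qa≡qb)

parabolas-convexInOrder : ∀ {n s t} (x : Fin n → ℚ) .{{s≥0 : NonNegative s}} →
  (∀ k → NonNegative (x k)) → s < t → (∀ {a b} → a <ᶠ b → x a < x b) →
  ConvexInOrder (λ k → parabolas s t (x k))
parabolas-convexInOrder {s = s} {t} x {{s≥0}} x≥0 s<t x-mono =
  Distinct-from-< first-coordinates-differ ,
  inj₁ λ a b c a<b b<c → orient-parabolas-pos s<t (x-mono a<b) (x-mono b<c)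
  where
  first-coordinates-differ : ∀ {a b} → a <ᶠ b → parabolas s t (x a) ≢ parabolas s t (x b)
  first-coordinates-differ {a} {b} a<b eq =
    parabola-injective {s} {{s≥0}} {{x≥0 a}} {{x≥0 b}} (x-mono a<b) (cong proj₁ eq)

parabolicPoints : ∀ {n d} → Fin n → Point d
parabolicPoints k i = parabola (toℚ (toℕ i)) (toℚ (toℕ k))

lemma1 : (d : ℕ) → d ≥ 2 → (n : ℕ) →
    Σ (Fin n → Point d) (λ P →
      (i j : Fin d) → i <ᶠ j → ConvexInOrder (λ k → proj i j (P k)))
lemma1 d _ n = parabolicPoints , λ i j i<j →
  parabolas-convexInOrder (λ k → toℚ (toℕ k)) {{toℚ-nonNeg (toℕ i)}}
    (λ k → toℚ-nonNeg (toℕ k)) (toℚ-mono-< i<j) toℚ-mono-<
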